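{- In the setting below, for $1\le i\le 2^r-1$, $$f_{\alpha(i)}(x)-f_{\alpha(i+1)}(x)=xq^{\alpha(i)}f_{v(\alpha(i))}\left(xq^{Nw(\alpha(i))}\right)+dxq^{\alpha(i)}f_{v(\alpha(i))}\left(xq^{N(w(\alpha(i))-1)}\right),$$ and $$f_{\alpha(2^r)}(x)=f_{a(1)}(xq^N).$$
   Context: Let $r\ge1$, let $A=\{a(1),\dots,a(r)\}$ be a set of $r$ distinct integers with $\sum_{i=1}^{k-1}a(i)<a(k)$ for $1\le k\le r$ and with the $2^r-1$ sums of nonempty subsets pairwise distinct, let $A'=\{\alpha(1)<\dots<\alpha(2^r-1)\}$ be the set of these sums, let $N\ge\alpha(2^r-1)$ be an integer, and set $\alpha(2^r):=a(r+1):=N+a(1)$. For $\alpha\in A'$, $w(\alpha)$ is the number of elements of $A$ in the unique subset summing to $\alpha$, and $v(\alpha)$ is its smallest element. An overpartition is a partition in which the first occurrence of each part size may be overlined (written non-increasingly, overlined copy of a size first). $A'_N$ is the set of positive integers congruent mod $N$ to an element of $A'$; $\beta_N(m)$ is the least positive residue of $m$ mod $N$; $\chi(\overline\lambda)=1$ if $\lambda$ is overlined and $0$ otherwise. $E(A'_N;k,n)$ counts overpartitions $n=\lambda_1+\dots+\lambda_s$ into parts from $A'_N$ with exactly $k$ non-overlined parts such that $\lambda_i-\lambda_{i+1}\ge N\big(w(\beta_N(\lambda_{i+1}))-1+\chi(\overline{\lambda_{i+1}})\big)+v(\beta_N(\lambda_{i+1}))-\beta_N(\lambda_{i+1})$.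 For a positive integer $c$, $p_c(k,m,n)$ is the number of such overpartitions of $n$ with $k$ non-overlined parts, exactly $m$ parts and smallest part $\ge c$. For $|d|,|x|,|q|<1$, $f_c(x)=f_c(d,x,q):=1+\sum_{n\ge1}\sum_{m\ge1}\sum_{k\ge0}p_c(k,m,n)d^kx^mq^n$. -}

module Defs where

open import Data.Nat as ℕ using (ℕ; zero; suc; _+_; _*_; _∸_; _≤ᵇ_; _<ᵇ_; _≡ᵇ_; _⊓_)
open import Data.Nat.DivMod using (_%_)
open import Data.Integer as ℤ using (ℤ; +_)
open import Data.Bool using (Bool; true; false; if_then_else_; _∧_; _∨_; not)
open import Data.Fin using (Fin; toℕ)
open import Data.Fin.Subset using (Subset; ∣_∣; Nonempty)
open import Data.Vec as Vec using (Vec; []; _∷_; lookup; tabulate)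
open import Data.List as List using (List; []; _∷_; map; length; filterᵇ; concatMap; allFin; applyUpTo; foldr)
open import Data.Nat.ListAction using (sum)
open import Data.Bool.ListAction using (all; any)
open import Data.Product using (Σ; _×_; _,_; proj₁; proj₂)
open import Relation.Binary.PropositionalEquality using (_≡_)

-- Subsets of A = {a(1),…,a(r)}, indexed by Fin r  (a(i) ↦ a (i-1))

ssum : ∀ {r} → (Fin r → ℕ) → Subset r → ℕ
ssum {r} a S = sum (map (λ j → if lookup S j then a j else 0) (allFin r))

below : ∀ {r} → Fin r → Subset r
below k = tabulate (λ j → toℕ j <ᵇ toℕ k)

InA' : ∀ {r} → (Fin r → ℕ) → ℕ → Set
InA' {r} a β = Σ (Subset r) λ S → Nonempty S × ssum a S ≡ β

subsets : (r : ℕ) → List (Subset r)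
subsets zero    = [] ∷ []
subsets (suc r) = concatMap (λ S → (true ∷ S) ∷ (false ∷ S) ∷ []) (subsets r)

nonemptyᵇ : ∀ {r} → Subset r → Bool
nonemptyᵇ S = 1 ≤ᵇ ∣ S ∣

-- the nonempty subsets summing to β (by the hypothesis on distinct
-- subset sums, there is at most one)
subsetsSumming : ∀ {r} → (Fin r → ℕ) → ℕ → List (Subset r)
subsetsSumming {r} a β = filterᵇ (λ S → nonemptyᵇ S ∧ (ssum a S ≡ᵇ β)) (subsets r)

minimumOr : ℕ → List ℕ → ℕ
minimumOr d []       = d
minimumOr d (x ∷ xs) = foldr _⊓_ x xs

minElem : ∀ {r} → (Fin r → ℕ) → Subset r → ℕ
minElem {r} a S = minimumOr 0 (List.map a (filterᵇ (lookup S) (allFin r)))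

-- w(β): number of elements in the unique subset summing to β
-- v(β): smallest element of that subset
-- (values for β ∉ A' are irrelevant; they default to 0)
w : ∀ {r} → (Fin r → ℕ) → ℕ → ℕ
w a β with subsetsSumming a β
... | []    = 0
... | S ∷ _ = ∣ S ∣

v : ∀ {r} → (Fin r → ℕ) → ℕ → ℕ
v a β with subsetsSumming a β
... | []    = 0
... | S ∷ _ = minElem a S

-- Residues mod N  (N ≥ 1 in the setting; N = 0 is given a dummy value)

_mod_ : ℕ → ℕ → ℕ
m mod zero    = m
m mod (suc n) = m % suc n

βN : ℕ → ℕ → ℕ
βN N m = if (m mod N) ≡ᵇ 0 then N else m mod N

inA'Nᵇ : ∀ {r} → (Fin r → ℕ) → ℕ → ℕ → Bool
inA'Nᵇ {r} a N m =
  (1 ≤ᵇ m) ∧ any (λ S → nonemptyᵇ S ∧ ((m mod N) ≡ᵇ (ssum a S mod N))) (subsets r)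

-- Overpartitions, written as lists of (part , overlined?) in the order
-- λ₁ , λ₂ , … , λ_s.

Part : Set
Part = ℕ × Bool

χ : Bool → ℕ
χ true  = 1
χ false = 0

markedComps : (fuel n : ℕ) → List (List Part)
markedComps _        zero = [] ∷ []
markedComps zero     (suc n) = []
markedComps (suc f)  (suc n) =
  concatMap (λ p → concatMap (λ b → map ((suc p , b) ∷_) (markedComps f (suc n ∸ suc p)))
                             (true ∷ false ∷ []))
            (applyUpTo (λ i → i) (suc n))

-- consecutive condition for λ_i = (p , b) followed by λ_{i+1} = (p' , b'):
--  * overpartition order: p ≥ p', and if p = p' then λ_{i+1} is not overlined
--    (overlined copy first, at most one overlined copy per size);
--  * difference condition
--    λ_i − λ_{i+1} ≥ N (w(β_N(λ_{i+1})) − 1 + χ(λ_{i+1})) + v(β_N(λ_{i+1})) − β_N(λ_{i+1})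
--    (computed in ℤ).
consecOK : ∀ {r} → (Fin r → ℕ) → ℕ → Part → Part → Bool
consecOK a N (p , b) (p' , b') =
  (p' ≤ᵇ p) ∧ (not (p ≡ᵇ p') ∨ not b')
  ∧ (((+ (N * (w a β + χ b'))) ℤ.- (+ N)) ℤ.+ (+ v a β) ℤ.- (+ β)
       ℤ.≤ᵇ ((+ p) ℤ.- (+ p')))
  where β = βN N p'

chainOK : ∀ {r} → (Fin r → ℕ) → ℕ → List Part → Bool
chainOK a N []                = true
chainOK a N (_ ∷ [])          = true
chainOK a N (x ∷ y ∷ ys)      = consecOK a N x y ∧ chainOK a N (y ∷ ys)

validᵇ : ∀ {r} → (Fin r → ℕ) → ℕ → List Part → Bool
validᵇ a N λs = all (λ x → inA'Nᵇ a N (proj₁ x)) λs ∧ chainOK a N λs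

nonOverlined : List Part → ℕ
nonOverlined λs = length (filterᵇ (λ x → not (proj₂ x)) λs)

-- p_c(k,m,n), extended to n = 0 where it counts the empty overpartition
-- (k = m = 0), i.e. exactly the coefficient of d^k x^m q^n in f_c.
pc : ∀ {r} → (Fin r → ℕ) → (N c k m n : ℕ) → ℕ
pc a N c k m n =
  length (filterᵇ
    (λ λs → validᵇ a N λs
            ∧ (nonOverlined λs ≡ᵇ k)
            ∧ (length λs ≡ᵇ m)
            ∧ all (λ x → c ≤ᵇ proj₁ x) λs)
    (markedComps n n))

-- Formal power series in d, x, q:  F k m n = coefficient of d^k x^m q^n

Series : Set
Series = ℕ → ℕ → ℕ → ℤ

_≋_ : Series → Series → Set
F ≋ G = ∀ k m n → F k m n ≡ G k m n

_⊕_ _⊖_ : Series → Series → Series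
(F ⊕ G) k m n = F k m n ℤ.+ G k m n
(F ⊖ G) k m n = F k m n ℤ.- G k m n

-- d^i x^j q^l · F
monomial : (i j l : ℕ) → Series → Series
monomial i j l F k m n =
  if (i ≤ᵇ k) ∧ (j ≤ᵇ m) ∧ (l ≤ᵇ n) then F (k ∸ i) (m ∸ j) (n ∸ l) else + 0

-- F(d, x q^t, q)
substXq : (t : ℕ) → Series → Series
substXq t F k m n = if t * m ≤ᵇ n then F k m (n ∸ t * m) else + 0

f : ∀ {r} → (Fin r → ℕ) → (N c : ℕ) → Series
f a N c k m n = + pc a N c k m n

-- An overpartition counted by f_{α(i)} but not by f_{α(i+1)} has its smallest part in
-- [α(i), α(i+1)), and the only element of A'_N there is α(i): inside any window of
-- length N an element of A'_N is determined by its residue, and those residues are the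
-- residues of the elements of A' = {α(1) < ... < α(2^r - 1)}.  As β_N(α(i)) = α(i), the
-- difference condition in front of a smallest part α(i) says precisely that all other
-- parts are at least g + v(α(i)) with g = N(w(α(i)) - 1 + χ), χ = 1 iff that smallest part
-- is overlined.  Removing the smallest part and lowering the others by g preserves
-- membership in A'_N and every difference condition (they depend only on residues mod N
-- and on differences of parts) and yields exactly the overpartitions counted by
-- f_{v(α(i))}: this is the term x q^{α(i)} f_{v(α(i))}(x q^g), with a factor d when the
-- smallest part is not overlined.  The second identity is the same lowering by N applied
-- to all parts.  Counts are lengths of filtered sublists of the duplicate-free
-- enumeration markedComps, so they are compared through injections onto the other set.

module Submission where

open import Defs
open import Data.Nat as ℕ
  using (ℕ; zero; suc; _+_; _*_; _∸_; _^_; _≤_; _<_; z≤n; s≤s; _≤ᵇ_; _≡ᵇ_; _⊓_; _%_; _/_; NonZero; _≤?_; >-nonZero)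
open import Data.Nat.Properties
open import Data.Nat.DivMod using (%-remove-+ˡ; m≡m%n+[m/n]*n; m<n⇒m%n≡m; n%n≡0)
open import Data.Nat.Divisibility using (_∣_; m∣m*n; ∣-refl)
open import Data.Nat.ListAction using (sum)
open import Data.Nat.ListAction.Properties using (sum-++)
open import Data.Nat.Tactic.RingSolver using (solve-∀)
open import Algebra.Properties.CommutativeSemigroup +-commutativeSemigroup using (x∙yz≈y∙xz; xy∙z≈xz∙y)
open import Data.Integer as ℤ using (ℤ; +_; +≤+)
import Data.Integer.Properties as ℤ
import Data.Integer.Tactic.RingSolver as ℤ-Solver
open import Data.Bool using (Bool; true; false; T; not; _∧_; _∨_; if_then_else_)
open import Data.Bool.Properties using (T-∧; T-∨; T-≡; T-not-≡; ⇔→≡)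
open import Data.Bool.ListAction using (all; any)
open import Data.Fin using (Fin; zero; suc)
open import Data.Fin.Subset using (Subset; Nonempty; ∣_∣; ⊤)
open import Data.Fin.Subset.Properties using (nonempty?; Empty-unique; ∣⊥∣≡0; x∈p⇒∣p-x∣<∣p∣; ∈⊤)
open import Data.Vec using ([]; _∷_; lookup)
open import Data.Vec.Properties using ([]=⇒lookup; lookup-replicate)
open import Data.Empty using (⊥-elim)
open import Data.Sum using (inj₁; inj₂)
open import Data.Product using (Σ; _×_; _,_; proj₁; proj₂; ∃)
open import Data.List
  using (List; []; _∷_; _++_; _∷ʳ_; map; length; filterᵇ; concatMap; upTo; allFin; tabulate; foldr; initLast; _∷ʳ′_)
open import Data.List.Properties
  using (length-map; length-++; map-++; map-injective; map-tabulate; ∷-injectiveʳ; ∷ʳ-injective)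
open import Data.List.Membership.Propositional using (_∈_; find; lose)
open import Data.List.Membership.Propositional.Properties
  using (∈-concatMap⁺; ∈-concatMap⁻; ∈-upTo⁺; ∈-upTo⁻; ∈-map⁺; ∈-map⁻; ∈-filter⁺; ∈-filter⁻; ∈-allFin)
open import Data.List.Membership.Propositional.Properties.WithK using (unique∧set⇒bag)
open import Data.List.Relation.Binary.BagAndSetEquality using (∼bag⇒↭)
open import Data.List.Relation.Binary.Permutation.Propositional.Properties using (↭-length)
open import Data.List.Relation.Unary.All as All using (All; []; _∷_)
import Data.List.Relation.Unary.All.Properties as All
open import Data.List.Relation.Unary.Any using (here; there)
open import Data.List.Relation.Unary.Any.Properties using (any⁺; any⁻)
open import Data.List.Relation.Unary.AllPairs using ([]; _∷_)
open import Data.List.Relation.Unary.Unique.Propositional using (Unique)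
import Data.List.Relation.Unary.Unique.Propositional.Properties as Unique
open import Function using (_∘_; id; case_of_; Injective)
open import Function.Bundles using (_⇔_; mk⇔; Equivalence)
import Function.Properties.Equivalence as ⇔
open import Relation.Nullary using (¬_; yes; no; T?)
open import Relation.Nullary.Decidable using (_×-dec_)
open import Relation.Binary.Definitions using (tri<; tri≈; tri>)
open import Relation.Binary.PropositionalEquality
  using (_≡_; refl; sym; trans; cong; cong₂; subst; subst₂; module ≡-Reasoning)

unique∧set⇒length-≡ : {A : Set} {xs ys : List A} → Unique xs → Unique ys →
                      (∀ {x} → x ∈ xs ⇔ x ∈ ys) → length xs ≡ length ys
unique∧set⇒length-≡ xs! ys! xs≈ys = ↭-length (∼bag⇒↭ (unique∧set⇒bag xs! ys! xs≈ys))

concatMap-unique : {A B : Set} (key : B → A) (F : A → List B) {xs : List A} → Unique xs →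
                   (∀ x → Unique (F x)) → (∀ x {y} → y ∈ F x → key y ≡ x) →
                   Unique (concatMap F xs)
concatMap-unique key F {[]}     []          F! keyF = []
concatMap-unique key F {x ∷ xs} (x∉ ∷ xs!) F! keyF =
  Unique.++⁺ (F! x) (concatMap-unique key F xs! F! keyF) disjoint
  where
  disjoint : ∀ {y} → ¬ (y ∈ F x × y ∈ concatMap F xs)
  disjoint (y∈Fx , y∈rest) with find (∈-concatMap⁻ F y∈rest)
  ... | x′ , x′∈xs , y∈Fx′ =
    All.lookup x∉ x′∈xs (trans (sym (keyF x y∈Fx)) (keyF x′ y∈Fx′))

length-filterᵇ-split : {A : Set} (P Q : A → Bool) (xs : List A) →
  length (filterᵇ P xs) ≡ length (filterᵇ (λ x → P x ∧ Q x) xs) + length (filterᵇ (λ x → P x ∧ not (Q x)) xs)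
length-filterᵇ-split P Q [] = refl
length-filterᵇ-split P Q (x ∷ xs) with P x | Q x
... | false | _     = length-filterᵇ-split P Q xs
... | true  | true  = cong suc (length-filterᵇ-split P Q xs)
... | true  | false = trans (cong suc (length-filterᵇ-split P Q xs)) (sym (+-suc _ _))

length-filterᵇ-map : ∀ {A B : Set} (p : B → Bool) (f : A → B) xs →
                     length (filterᵇ p (map f xs)) ≡ length (filterᵇ (p ∘ f) xs)
length-filterᵇ-map p f []       = refl
length-filterᵇ-map p f (x ∷ xs) with p (f x)
... | true  = cong suc (length-filterᵇ-map p f xs)
... | false = length-filterᵇ-map p f xs

sum-map-if : ∀ {A : Set} (p : A → Bool) (f : A → ℕ) xs →
             sum (map (λ x → if p x then f x else 0) xs) ≡ sum (map f (filterᵇ p xs))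
sum-map-if p f []       = refl
sum-map-if p f (x ∷ xs) with p x
... | true  = cong (λ s → f x + s) (sum-map-if p f xs)
... | false = sum-map-if p f xs

length-∷ʳ : ∀ {A : Set} (xs : List A) x → length (xs ∷ʳ x) ≡ suc (length xs)
length-∷ʳ xs x = trans (length-++ xs) (+-comm (length xs) 1)

⊓-fold-≤ : ∀ x ys → foldr _⊓_ x ys ≤ x
⊓-fold-≤ x []       = ≤-refl
⊓-fold-≤ x (y ∷ ys) = ≤-trans (m⊓n≤n y _) (⊓-fold-≤ x ys)

⊓-fold-positive : ∀ {x ys} → 1 ≤ x → All (1 ≤_) ys → 1 ≤ foldr _⊓_ x ys
⊓-fold-positive 1≤x []           = 1≤x
⊓-fold-positive 1≤x (1≤y ∷ 1≤ys) = ⊓-glb 1≤y (⊓-fold-positive 1≤x 1≤ys)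

sum≤⊓-fold+ : ∀ {N} x ys → x ≤ N → All (_≤ N) ys → x + sum ys ≤ foldr _⊓_ x ys + length ys * N
sum≤⊓-fold+ x []       _   []           = ≤-refl
sum≤⊓-fold+ {N} x (y ∷ ys) x≤N (y≤N ∷ ys≤N) with ≤-total y (foldr _⊓_ x ys)
... | inj₁ y≤μ rewrite m≤n⇒m⊓n≡m y≤μ = begin
  x + (y + sum ys)        ≡⟨ x∙yz≈y∙xz x y (sum ys) ⟩
  y + (x + sum ys)        ≤⟨ +-monoʳ-≤ y (sum≤⊓-fold+ x ys x≤N ys≤N) ⟩
  y + (μ + length ys * N) ≤⟨ +-monoʳ-≤ y (+-monoˡ-≤ _ (≤-trans (⊓-fold-≤ x ys) x≤N)) ⟩
  y + (N + length ys * N) ∎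
  where open ≤-Reasoning
        μ = foldr _⊓_ x ys
... | inj₂ μ≤y rewrite m≥n⇒m⊓n≡n μ≤y = begin
  x + (y + sum ys)        ≡⟨ x∙yz≈y∙xz x y (sum ys) ⟩
  y + (x + sum ys)        ≤⟨ +-mono-≤ y≤N (sum≤⊓-fold+ x ys x≤N ys≤N) ⟩
  N + (μ + length ys * N) ≡⟨ x∙yz≈y∙xz N μ _ ⟩
  μ + (N + length ys * N) ∎
  where open ≤-Reasoning
        μ = foldr _⊓_ x ys

minimum-bounds : ∀ {N} ys → 1 ≤ length ys → All (1 ≤_) ys → All (_≤ N) ys →
                 1 ≤ minimumOr 0 ys × sum ys ≤ minimumOr 0 ys + (length ys ∸ 1) * N
minimum-bounds (y ∷ ys) _ (1≤y ∷ 1≤ys) (y≤N ∷ ys≤N) = ⊓-fold-positive 1≤y 1≤ys , sum≤⊓-fold+ y ys y≤N ys≤N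

if-T : ∀ {A : Set} {c} {x y : A} → T c → (if c then x else y) ≡ x
if-T {c = true} _ = refl

if-¬T : ∀ {A : Set} {c} {x y : A} → ¬ T c → (if c then x else y) ≡ y
if-¬T {c = false} _  = refl
if-¬T {c = true}  ¬t = ⊥-elim (¬t _)

T-not⇔¬T : ∀ {x} → T (not x) ⇔ (¬ T x)
T-not⇔¬T {false} = mk⇔ (λ _ ()) (λ _ → _)
T-not⇔¬T {true}  = mk⇔ (λ ()) (λ ¬t → ¬t _)

T-injective : ∀ {x y} → (T x ⇔ T y) → x ≡ y
T-injective Tx⇔Ty = ⇔→≡ (⇔.trans (⇔.sym T-≡) (⇔.trans Tx⇔Ty T-≡))

≤ᵇ-cancelˡ : ∀ s {m n} → (s + m ≤ᵇ s + n) ≡ (m ≤ᵇ n)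
≤ᵇ-cancelˡ s = T-injective (mk⇔ (≤⇒≤ᵇ ∘ +-cancelˡ-≤ s _ _ ∘ ≤ᵇ⇒≤ _ _) (≤⇒≤ᵇ ∘ +-monoʳ-≤ s ∘ ≤ᵇ⇒≤ _ _))

≡ᵇ-cancelˡ : ∀ s {m n} → (s + m ≡ᵇ s + n) ≡ (m ≡ᵇ n)
≡ᵇ-cancelˡ zero    = refl
≡ᵇ-cancelˡ (suc s) = ≡ᵇ-cancelˡ s

m+n≡o⇔ : ∀ {m n o} → m + n ≡ o ⇔ (m ≤ o × n ≡ o ∸ m)
m+n≡o⇔ {m} {n} = mk⇔ (λ { refl → m≤m+n m n , sym (m+n∸m≡n m n) })
                     (λ (m≤o , n≡) → trans (cong (λ x → m + x) n≡) (m+[n∸m]≡n m≤o))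

m+n+p≡o⇔ : ∀ {m n p o} → m + n + p ≡ o ⇔ (p ≤ o × m ≤ o ∸ p × n ≡ o ∸ p ∸ m)
m+n+p≡o⇔ {m} {n} {p} = mk⇔
  (λ sum≡ → let p≤o , m+n≡ = Equivalence.to m+n≡o⇔ (trans (+-comm p (m + n)) sum≡)
            in p≤o , Equivalence.to m+n≡o⇔ m+n≡)
  (λ (p≤o , rest) → trans (+-comm (m + n) p) (Equivalence.from m+n≡o⇔ (p≤o , Equivalence.from m+n≡o⇔ rest)))

%-injective-close : ∀ {x y N} .{{_ : NonZero N}} → x ≤ y → y < x + N → x % N ≡ y % N → x ≡ y
%-injective-close {x} {y} {N} x≤y y<x+N x%≡y% = ≤-antisym x≤y (m∸n≡0⇒m≤n y∸x≡0)
  where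
  open ≡-Reasoning
  y∸x≡qN : y ∸ x ≡ (y / N ∸ x / N) * N
  y∸x≡qN = begin
    y ∸ x                                     ≡⟨ cong₂ _∸_ (m≡m%n+[m/n]*n y N) (m≡m%n+[m/n]*n x N) ⟩
    (y % N + y / N * N) ∸ (x % N + x / N * N) ≡⟨ cong (λ ρ → (ρ + y / N * N) ∸ (x % N + x / N * N)) (sym x%≡y%) ⟩
    (x % N + y / N * N) ∸ (x % N + x / N * N) ≡⟨ [m+n]∸[m+o]≡n∸o (x % N) _ _ ⟩
    y / N * N ∸ x / N * N                     ≡⟨ *-distribʳ-∸ N (y / N) (x / N) ⟨
    (y / N ∸ x / N) * N                       ∎
  y∸x≡0 : y ∸ x ≡ 0
  y∸x≡0 with y / N ∸ x / N | y∸x≡qN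
  ... | zero  | eq = eq
  ... | suc q | eq = ⊥-elim (<⇒≱ (m<n+o⇒m∸n<o y x y<x+N) (subst (N ≤_) (sym eq) (m≤m+n N (q * N))))

%-injective-window : ∀ {c x y N} .{{_ : NonZero N}} →
                     c ≤ x → x < c + N → c ≤ y → y < c + N → x % N ≡ y % N → x ≡ y
%-injective-window {c} {x} {y} c≤x x<c+N c≤y y<c+N x%≡y% with ≤-total x y
... | inj₁ x≤y = %-injective-close x≤y (<-≤-trans y<c+N (+-monoˡ-≤ _ c≤x)) x%≡y%
... | inj₂ y≤x = sym (%-injective-close y≤x (<-≤-trans x<c+N (+-monoˡ-≤ _ c≤y)) (sym x%≡y%))

≤-by-offset⇔ : ∀ {x y : ℤ} (K : ℤ) {A B : ℕ} → x ℤ.+ K ≡ + A → y ℤ.+ K ≡ + B → x ℤ.≤ y ⇔ A ≤ B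
≤-by-offset⇔ {x} {y} K x+K≡A y+K≡B = mk⇔
  (λ x≤y → ℤ.drop‿+≤+ (subst₂ ℤ._≤_ x+K≡A y+K≡B (ℤ.+-monoˡ-≤ K x≤y)))
  (λ A≤B → subst₂ ℤ._≤_ (cancel x) (cancel y)
             (ℤ.+-monoˡ-≤ (ℤ.- K) (subst₂ ℤ._≤_ (sym x+K≡A) (sym y+K≡B) (+≤+ A≤B))))
  where
  cancel : ∀ z → z ℤ.+ K ℤ.- K ≡ z
  cancel z = solve z K
    where solve : ∀ z k → z ℤ.+ k ℤ.- k ≡ z
          solve = ℤ-Solver.solve-∀

difference-≤ᵇ⇔ : ∀ A B C D E →
  T ((+ A) ℤ.- (+ B) ℤ.+ (+ C) ℤ.- (+ D) ℤ.≤ᵇ (+ E) ℤ.- (+ D)) ⇔ A + C ≤ E + B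
difference-≤ᵇ⇔ A B C D E = ⇔.trans (mk⇔ (ℤ.≤ᵇ⇒≤ {x}) ℤ.≤⇒≤ᵇ) (≤-by-offset⇔ (+ B ℤ.+ + D) lhs rhs)
  where
  x = (+ A) ℤ.- (+ B) ℤ.+ (+ C) ℤ.- (+ D)
  lhs : x ℤ.+ (+ B ℤ.+ + D) ≡ + (A + C)
  lhs = trans (solve (+ A) (+ B) (+ C) (+ D)) (sym (ℤ.pos-+ A C))
    where solve : ∀ a b c d → a ℤ.- b ℤ.+ c ℤ.- d ℤ.+ (b ℤ.+ d) ≡ a ℤ.+ c
          solve = ℤ-Solver.solve-∀
  rhs : (+ E) ℤ.- (+ D) ℤ.+ (+ B ℤ.+ + D) ≡ + (E + B)
  rhs = trans (solve (+ E) (+ B) (+ D)) (sym (ℤ.pos-+ E B))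
    where solve : ∀ e b d → e ℤ.- d ℤ.+ (b ℤ.+ d) ≡ e ℤ.+ b
          solve = ℤ-Solver.solve-∀

[+[m+n]]-[+m]≡+n : ∀ x y → + (x + y) ℤ.- + x ≡ + y
[+[m+n]]-[+m]≡+n x y = trans (cong (ℤ._- + x) (ℤ.pos-+ x y)) (solve (+ x) (+ y))
  where solve : ∀ x y → x ℤ.+ y ℤ.- x ≡ y
        solve = ℤ-Solver.solve-∀

[+[m+n]]-[+[m+o]]≡[+n]-[+o] : ∀ s p q → (+ (s + p)) ℤ.- (+ (s + q)) ≡ (+ p) ℤ.- (+ q)
[+[m+n]]-[+[m+o]]≡[+n]-[+o] s p q = begin
  + (s + p) ℤ.- + (s + q) ≡⟨ ℤ.[+m]-[+n]≡m⊖n (s + p) (s + q) ⟩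
  (s + p) ℤ.⊖ (s + q)     ≡⟨ ℤ.+-cancelˡ-⊖ s p q ⟩
  p ℤ.⊖ q                 ≡⟨ ℤ.[+m]-[+n]≡m⊖n p q ⟨
  + p ℤ.- + q             ∎
  where open ≡-Reasoning

substXq-fits : ∀ t F k m n → t * m ≤ n → substXq t F k m n ≡ F k m (n ∸ t * m)
substXq-fits t F k m n = if-T ∘ ≤⇒≤ᵇ

substXq-unfit : ∀ t F k m n → ¬ t * m ≤ n → substXq t F k m n ≡ + 0
substXq-unfit t F k m n ¬fits = if-¬T (¬fits ∘ ≤ᵇ⇒≤ _ _)

monomial-fits : ∀ i j l G k m n → i ≤ k × j ≤ m × l ≤ n →
                monomial i j l G k m n ≡ G (k ∸ i) (m ∸ j) (n ∸ l)
monomial-fits i j l G k m n (i≤k , j≤m , l≤n) =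
  if-T (Equivalence.from T-∧ (≤⇒≤ᵇ i≤k , Equivalence.from T-∧ (≤⇒≤ᵇ j≤m , ≤⇒≤ᵇ l≤n)))

monomial-unfit : ∀ i j l G k m n → ¬ (i ≤ k × j ≤ m × l ≤ n) → monomial i j l G k m n ≡ + 0
monomial-unfit i j l G k m n ¬fits = if-¬T λ t →
  let i≤k , t′ = Equivalence.to (T-∧ {i ≤ᵇ k}) t
      j≤m , l≤n = Equivalence.to (T-∧ {j ≤ᵇ m}) t′
  in ¬fits (≤ᵇ⇒≤ _ _ i≤k , ≤ᵇ⇒≤ _ _ j≤m , ≤ᵇ⇒≤ _ _ l≤n)

monomial-substXq-fits : ∀ i j l t F k m n → i ≤ k × j ≤ m × l ≤ n → t * (m ∸ j) ≤ n ∸ l →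
  monomial i j l (substXq t F) k m n ≡ F (k ∸ i) (m ∸ j) (n ∸ l ∸ t * (m ∸ j))
monomial-substXq-fits i j l t F k m n support fits =
  trans (monomial-fits i j l (substXq t F) k m n support) (substXq-fits t F (k ∸ i) (m ∸ j) (n ∸ l) fits)

monomial-substXq-unfit : ∀ i j l t F k m n → ¬ ((i ≤ k × j ≤ m × l ≤ n) × t * (m ∸ j) ≤ n ∸ l) →
  monomial i j l (substXq t F) k m n ≡ + 0
monomial-substXq-unfit i j l t F k m n ¬fits with (i ≤? k) ×-dec (j ≤? m) ×-dec (l ≤? n)
... | yes support = trans (monomial-fits i j l (substXq t F) k m n support)
                          (substXq-unfit t F (k ∸ i) (m ∸ j) (n ∸ l) (λ fits → ¬fits (support , fits)))
... | no ¬support = monomial-unfit i j l (substXq t F) k m n ¬support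

-- Compositions and counting

infix 4 _≤ₚ_
_≤ₚ_ : ℕ → Part → Set
c ≤ₚ x = c ≤ proj₁ x

weight : List Part → ℕ
weight L = sum (map proj₁ L)

Composition : ℕ → List Part → Set
Composition n L = All (1 ≤ₚ_) L × weight L ≡ n

headedBy : ℕ → ℕ → ℕ → Bool → List (List Part)
headedBy f n p b = map ((suc p , b) ∷_) (markedComps f (suc n ∸ suc p))

headedBySize : ℕ → ℕ → ℕ → List (List Part)
headedBySize f n p = concatMap (headedBy f n p) (true ∷ false ∷ [])

markedComps-sound : ∀ f n {L} → L ∈ markedComps f n → Composition n L
markedComps-sound f zero (here refl) = [] , refl
markedComps-sound (suc f) (suc n) L∈ with find (∈-concatMap⁻ (headedBySize f n) {xs = upTo (suc n)} L∈)
... | p , p∈ , L∈′ with find (∈-concatMap⁻ (headedBy f n p) {xs = true ∷ false ∷ []} L∈′)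
... | b , _ , L∈″ with ∈-map⁻ ((suc p , b) ∷_) L∈″
... | L′ , L′∈ , refl with markedComps-sound f (n ∸ p) L′∈
... | pos , wt = s≤s z≤n ∷ pos , cong suc (trans (cong (λ w → p + w) wt) (m+[n∸m]≡n (≤-pred (∈-upTo⁻ p∈))))

markedComps-complete : ∀ {f n L} → n ≤ f → Composition n L → L ∈ markedComps f n
markedComps-complete {L = []} _ (_ , refl) = here refl
markedComps-complete {suc f} {L = (suc p , b) ∷ L} (s≤s n≤f) (_ ∷ pos , refl) =
  ∈-concatMap⁺ (headedBySize f n) {xs = upTo (suc n)} (lose p∈ (∈-concatMap⁺ (headedBy f n p) (lose b∈ L∈)))
  where
  n = p + weight L
  p∈ : p ∈ upTo (suc n)
  p∈ = ∈-upTo⁺ (s≤s (m≤m+n p (weight L)))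
  b∈ : b ∈ true ∷ false ∷ []
  b∈ = mark∈ b
    where
    mark∈ : ∀ b → b ∈ true ∷ false ∷ []
    mark∈ true  = here refl
    mark∈ false = there (here refl)
  L∈ : (suc p , b) ∷ L ∈ headedBy f n p b
  L∈ = ∈-map⁺ ((suc p , b) ∷_) (subst (L ∈_) (cong (markedComps f) (sym (m+n∸m≡n p (weight L))))
         (markedComps-complete (≤-trans (m≤n+m (weight L) p) n≤f) (pos , refl)))
markedComps-complete {zero} {L = _ ∷ _} () (s≤s z≤n ∷ _ , refl)

headPart : List Part → Part
headPart []      = 0 , false
headPart (x ∷ _) = x

headPart-headedBy : ∀ {f n p b L} → L ∈ headedBy f n p b → headPart L ≡ (suc p , b)
headPart-headedBy {p = p} {b} L∈ with ∈-map⁻ ((suc p , b) ∷_) L∈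
... | _ , _ , refl = refl

markedComps-unique : ∀ f n → Unique (markedComps f n)
markedComps-unique f       zero    = [] ∷ []
markedComps-unique zero    (suc n) = []
markedComps-unique (suc f) (suc n) =
  concatMap-unique (ℕ.pred ∘ proj₁ ∘ headPart) (headedBySize f n) (Unique.upTo⁺ (suc n))
    (λ p → concatMap-unique (proj₂ ∘ headPart) (headedBy f n p) (((λ ()) ∷ []) ∷ [] ∷ [])
             (λ b → Unique.map⁺ ∷-injectiveʳ (markedComps-unique f (n ∸ p)))
             (λ b L∈ → cong proj₂ (headPart-headedBy L∈)))
    (λ p L∈ → let b , _ , L∈′ = find (∈-concatMap⁻ (headedBy f n p) {xs = true ∷ false ∷ []} L∈)
              in cong (ℕ.pred ∘ proj₁) (headPart-headedBy L∈′))

count : (List Part → Bool) → ℕ → ℕ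
count P n = length (filterᵇ P (markedComps n n))

Counted : (List Part → Bool) → ℕ → List Part → Set
Counted P n L = T (P L) × Composition n L

module _ {P : List Part → Bool} {n : ℕ} where

  ∈-count⇔ : ∀ {L} → L ∈ filterᵇ P (markedComps n n) ⇔ Counted P n L
  ∈-count⇔ = mk⇔ (λ L∈ → let L∈′ , t = ∈-filter⁻ (T? ∘ P) L∈ in t , markedComps-sound n n L∈′)
                 (λ (t , comp) → ∈-filter⁺ (T? ∘ P) (markedComps-complete ≤-refl comp) t)

  count-unique : Unique (filterᵇ P (markedComps n n))
  count-unique = Unique.filter⁺ (T? ∘ P) (markedComps-unique n n)

  count-zero : (∀ {L} → ¬ Counted P n L) → count P n ≡ 0
  count-zero none = empty (filterᵇ P (markedComps n n)) (none ∘ Equivalence.to ∈-count⇔)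
    where
    empty : (xs : List (List Part)) → (∀ {L} → ¬ L ∈ xs) → length xs ≡ 0
    empty []      _  = refl
    empty (_ ∷ _) ∉xs = ⊥-elim (∉xs (here refl))

count-≡-by-embedding : ∀ {P Q n n′} (h : List Part → List Part) → Injective _≡_ _≡_ h →
  (∀ {L} → Counted Q n′ L → Counted P n (h L)) →
  (∀ {L} → Counted P n L → ∃ λ L′ → Counted Q n′ L′ × h L′ ≡ L) →
  count P n ≡ count Q n′
count-≡-by-embedding {P} {Q} {n} {n′} h h-inj h-into h-onto =
  trans (unique∧set⇒length-≡ (count-unique {P} {n}) (Unique.map⁺ h-inj (count-unique {Q} {n′})) (mk⇔ to from))
        (length-map h (filterᵇ Q (markedComps n′ n′)))
  where
  to : ∀ {L} → L ∈ filterᵇ P (markedComps n n) → L ∈ map h (filterᵇ Q (markedComps n′ n′))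
  to L∈ with h-onto (Equivalence.to ∈-count⇔ L∈)
  ... | L′ , counted , refl = ∈-map⁺ h (Equivalence.from ∈-count⇔ counted)
  from : ∀ {L} → L ∈ map h (filterᵇ Q (markedComps n′ n′)) → L ∈ filterᵇ P (markedComps n n)
  from L∈ with ∈-map⁻ h L∈
  ... | L′ , L′∈ , refl = Equivalence.from ∈-count⇔ (h-into (Equivalence.to ∈-count⇔ L′∈))

count-cong : ∀ {P Q n} → (∀ {L} → Composition n L → T (P L) ⇔ T (Q L)) → count P n ≡ count Q n
count-cong P⇔Q = count-≡-by-embedding id id
  (λ (q , comp) → Equivalence.from (P⇔Q comp) q , comp)
  (λ {L} (p , comp) → L , (Equivalence.to (P⇔Q comp) p , comp) , refl)

count-split : ∀ P Q n → count P n ≡ count (λ L → P L ∧ Q L) n + count (λ L → P L ∧ not (Q L)) n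
count-split P Q n = length-filterᵇ-split P Q (markedComps n n)

raise : ℕ → Part → Part
raise s x = s + proj₁ x , proj₂ x

map-raise-injective : ∀ s → Injective _≡_ _≡_ (map (raise s))
map-raise-injective s = map-injective λ eq → cong₂ _,_ (+-cancelˡ-≡ s _ _ (cong proj₁ eq)) (cong proj₂ eq)

weight-raise : ∀ s L → weight (map (raise s) L) ≡ s * length L + weight L
weight-raise s []      = sym (trans (+-identityʳ (s * 0)) (*-zeroʳ s))
weight-raise s (x ∷ L) = begin
  s + proj₁ x + weight (map (raise s) L)    ≡⟨ cong (λ w → s + proj₁ x + w) (weight-raise s L) ⟩
  s + proj₁ x + (s * length L + weight L)   ≡⟨ solve s (proj₁ x) (length L) (weight L) ⟩
  s * suc (length L) + (proj₁ x + weight L) ∎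
  where
  open ≡-Reasoning
  solve : ∀ s p l w → s + p + (s * l + w) ≡ s * suc l + (p + w)
  solve = solve-∀

nonOverlined-raise : ∀ s L → nonOverlined (map (raise s) L) ≡ nonOverlined L
nonOverlined-raise s []              = refl
nonOverlined-raise s ((p , true) ∷ L)  = nonOverlined-raise s L
nonOverlined-raise s ((p , false) ∷ L) = cong suc (nonOverlined-raise s L)

raised-decomposition : ∀ s {c} L → All ((s + c) ≤ₚ_) L → ∃ λ L′ → All (c ≤ₚ_) L′ × map (raise s) L′ ≡ L
raised-decomposition s []            []             = [] , [] , refl
raised-decomposition s {c} ((p , b) ∷ L) (s+c≤p ∷ les) with raised-decomposition s L les
... | L′ , L′≥c , refl =
  (p ∸ s , b) ∷ L′ ,
  subst (_≤ p ∸ s) (m+n∸m≡n s c) (∸-monoˡ-≤ s s+c≤p) ∷ L′≥c ,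
  cong (λ q → (q , b) ∷ map (raise s) L′) (m+[n∸m]≡n (≤-trans (m≤m+n s c) s+c≤p))

weight-∷ʳ : ∀ xs x → weight (xs ∷ʳ x) ≡ weight xs + proj₁ x
weight-∷ʳ xs x = trans (cong sum (map-++ proj₁ xs (x ∷ []))) (trans (sum-++ (map proj₁ xs) (proj₁ x ∷ []))
                   (cong (λ w → weight xs + w) (+-identityʳ (proj₁ x))))

nonOverlined-∷ʳ : ∀ xs p b → nonOverlined (xs ∷ʳ (p , b)) ≡ nonOverlined xs + χ (not b)
nonOverlined-∷ʳ []               p true  = refl
nonOverlined-∷ʳ []               p false = refl
nonOverlined-∷ʳ ((q , true) ∷ xs)  p b = nonOverlined-∷ʳ xs p b
nonOverlined-∷ʳ ((q , false) ∷ xs) p b = cong suc (nonOverlined-∷ʳ xs p b)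

lastMark : List Part → Bool
lastMark []           = false
lastMark (x ∷ [])     = proj₂ x
lastMark (_ ∷ y ∷ ys) = lastMark (y ∷ ys)

lastMark-∷ʳ : ∀ xs x → lastMark (xs ∷ʳ x) ≡ proj₂ x
lastMark-∷ʳ []           x = refl
lastMark-∷ʳ (_ ∷ [])     x = refl
lastMark-∷ʳ (_ ∷ y ∷ ys) x = lastMark-∷ʳ (y ∷ ys) x

lastMarkedᵇ : Bool → List Part → Bool
lastMarkedᵇ true  L = lastMark L
lastMarkedᵇ false L = not (lastMark L)

T-lastMarkedᵇ : ∀ b {L} → T (lastMarkedᵇ b L) ⇔ lastMark L ≡ b
T-lastMarkedᵇ true  = T-≡
T-lastMarkedᵇ false = T-not-≡

atLeastᵇ : ℕ → List Part → Bool
atLeastᵇ c L = all (λ x → c ≤ᵇ proj₁ x) L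

T-atLeastᵇ : ∀ {c L} → T (atLeastᵇ c L) ⇔ All (c ≤ₚ_) L
T-atLeastᵇ {L = L} = mk⇔ (All.map (≤ᵇ⇒≤ _ _) ∘ All.all⁺ _ L) (All.all⁻ _ ∘ All.map ≤⇒≤ᵇ)

-- The overpartitions counted by p_c

module Overpartitions {r : ℕ} (a : Fin r → ℕ) (N-1 : ℕ) where

  N : ℕ
  N = suc N-1

  βN-raise : ∀ {s} p → N ∣ s → βN N (s + p) ≡ βN N p
  βN-raise p N∣s = cong (λ ρ → if ρ ≡ᵇ 0 then N else ρ) (%-remove-+ˡ p N∣s)

  inA'N-raise : ∀ {s p} → N ∣ s → 1 ≤ p → inA'Nᵇ a N (s + p) ≡ inA'Nᵇ a N p
  inA'N-raise {s} {p} N∣s 1≤p = cong₂ _∧_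
    (trans (Equivalence.to T-≡ (≤⇒≤ᵇ (≤-trans 1≤p (m≤n+m p s)))) (sym (Equivalence.to T-≡ (≤⇒≤ᵇ 1≤p))))
    (cong (λ ρ → any (λ S → nonemptyᵇ S ∧ (ρ ≡ᵇ ssum a S mod N)) (subsets r))
          (%-remove-+ˡ p N∣s))

  consecOK-raise : ∀ {s} → N ∣ s → ∀ x y → consecOK a N (raise s x) (raise s y) ≡ consecOK a N x y
  consecOK-raise {s} N∣s (p , b) (q , c)
    rewrite βN-raise q N∣s | ≤ᵇ-cancelˡ s {q} {p} | ≡ᵇ-cancelˡ s {p} {q} | [+[m+n]]-[+[m+o]]≡[+n]-[+o] s p q = refl

  chainOK-raise : ∀ {s} → N ∣ s → ∀ L → chainOK a N (map (raise s) L) ≡ chainOK a N L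
  chainOK-raise N∣s []           = refl
  chainOK-raise N∣s (_ ∷ [])     = refl
  chainOK-raise N∣s (x ∷ y ∷ L) = cong₂ _∧_ (consecOK-raise N∣s x y) (chainOK-raise N∣s (y ∷ L))

  consecOK-decreasing : ∀ {x y} → T (consecOK a N x y) → proj₁ y ≤ proj₁ x
  consecOK-decreasing {p , _} {q , _} t = ≤ᵇ⇒≤ _ _ (proj₁ (Equivalence.to (T-∧ {q ≤ᵇ p}) t))

  chainOK-∷ʳ⁻ : ∀ {B z} → (∀ {u} → T (consecOK a N u z) → B ≤ₚ u) →
                ∀ xs → T (chainOK a N (xs ∷ʳ z)) → T (chainOK a N xs) × All (B ≤ₚ_) xs
  chainOK-∷ʳ⁻ bound []           _ = _ , []
  chainOK-∷ʳ⁻ {z = z} bound (x ∷ []) t = _ , bound {x} (proj₁ (Equivalence.to (T-∧ {consecOK a N x z}) t)) ∷ []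
  chainOK-∷ʳ⁻ {B} {z} bound (x ∷ y ∷ ys) t =
    let x▹y , rest = Equivalence.to (T-∧ {consecOK a N x y}) t
        chain , B≤y∷ys = chainOK-∷ʳ⁻ {B} {z} (λ {u} → bound {u}) (y ∷ ys) rest
    in Equivalence.from (T-∧ {consecOK a N x y}) (x▹y , chain) ,
       ≤-trans (All.head B≤y∷ys) (consecOK-decreasing {x} {y} x▹y) ∷ B≤y∷ys

  chainOK-∷ʳ⁺ : ∀ {B z} → (∀ {u} → B ≤ₚ u → T (consecOK a N u z)) →
                ∀ xs → T (chainOK a N xs) → All (B ≤ₚ_) xs → T (chainOK a N (xs ∷ʳ z))
  chainOK-∷ʳ⁺ bound []           _ _          = _
  chainOK-∷ʳ⁺ {z = z} bound (x ∷ []) _ (B≤x ∷ []) = Equivalence.from (T-∧ {consecOK a N x z}) (bound {x} B≤x , _)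
  chainOK-∷ʳ⁺ {B} {z} bound (x ∷ y ∷ ys) t (_ ∷ B≤y∷ys) =
    let x▹y , rest = Equivalence.to (T-∧ {consecOK a N x y}) t
    in Equivalence.from (T-∧ {consecOK a N x y}) (x▹y , chainOK-∷ʳ⁺ {B} {z} (λ {u} → bound {u}) (y ∷ ys) rest B≤y∷ys)

  -- pc a N c k m n is count (overpartitionᵇ c k m) n by definition.
  overpartitionᵇ : (c k m : ℕ) → List Part → Bool
  overpartitionᵇ c k m L =
    validᵇ a N L ∧ (nonOverlined L ≡ᵇ k) ∧ (length L ≡ᵇ m) ∧ atLeastᵇ c L

  record Overpartition (c k m : ℕ) (L : List Part) : Set where
    field
      inA'N          : All (λ x → T (inA'Nᵇ a N (proj₁ x))) L
      chain          : T (chainOK a N L)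
      nonOverlined≡  : nonOverlined L ≡ k
      length≡        : length L ≡ m
      lowerBound     : All (c ≤ₚ_) L

  T-overpartitionᵇ : ∀ {c k m L} → T (overpartitionᵇ c k m L) ⇔ Overpartition c k m L
  T-overpartitionᵇ {c} {k} {m} {L} = mk⇔ to from
    where
    inA'Nᵇ* = all (λ x → inA'Nᵇ a N (proj₁ x)) L
    to : T (overpartitionᵇ c k m L) → Overpartition c k m L
    to t =
      let valid , t₁  = Equivalence.to (T-∧ {validᵇ a N L}) t
          inA , chain = Equivalence.to (T-∧ {inA'Nᵇ*}) valid
          k≡ , t₂     = Equivalence.to (T-∧ {nonOverlined L ≡ᵇ k}) t₁
          m≡ , lower  = Equivalence.to (T-∧ {length L ≡ᵇ m}) t₂
      in record { inA'N = All.all⁺ _ L inA ; chain = chain ; nonOverlined≡ = ≡ᵇ⇒≡ _ _ k≡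
                ; length≡ = ≡ᵇ⇒≡ _ _ m≡ ; lowerBound = Equivalence.to T-atLeastᵇ lower }
    from : Overpartition c k m L → T (overpartitionᵇ c k m L)
    from π = Equivalence.from (T-∧ {validᵇ a N L})
      ( Equivalence.from (T-∧ {inA'Nᵇ*}) (All.all⁻ _ inA'N , chain)
      , Equivalence.from (T-∧ {nonOverlined L ≡ᵇ k}) (≡⇒≡ᵇ _ _ nonOverlined≡
      , Equivalence.from (T-∧ {length L ≡ᵇ m}) (≡⇒≡ᵇ _ _ length≡ , Equivalence.from T-atLeastᵇ lowerBound)))
      where open Overpartition π

  all-inA'N-raise : ∀ {s} → N ∣ s → ∀ {L} → All (1 ≤ₚ_) L →
    all (λ x → inA'Nᵇ a N (proj₁ x)) (map (raise s) L) ≡ all (λ x → inA'Nᵇ a N (proj₁ x)) L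
  all-inA'N-raise N∣s []           = refl
  all-inA'N-raise N∣s (1≤x ∷ 1≤L) = cong₂ _∧_ (inA'N-raise N∣s 1≤x) (all-inA'N-raise N∣s 1≤L)

  all-≤ᵇ-raise : ∀ s c L → all (λ x → s + c ≤ᵇ proj₁ x) (map (raise s) L) ≡ all (λ x → c ≤ᵇ proj₁ x) L
  all-≤ᵇ-raise s c []      = refl
  all-≤ᵇ-raise s c (x ∷ L) = cong₂ _∧_ (≤ᵇ-cancelˡ s) (all-≤ᵇ-raise s c L)

  overpartitionᵇ-raise : ∀ {s c k m L} → N ∣ s → All (1 ≤ₚ_) L →
    overpartitionᵇ (s + c) k m (map (raise s) L) ≡ overpartitionᵇ c k m L
  overpartitionᵇ-raise {s} {c} {k} {m} {L} N∣s 1≤L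
    rewrite all-inA'N-raise N∣s 1≤L | chainOK-raise N∣s L | nonOverlined-raise s L
          | length-map (raise s) L | all-≤ᵇ-raise s c L = refl

  Overpartition-raise⇔ : ∀ {s c k m L} → N ∣ s → All (1 ≤ₚ_) L →
    Overpartition c k m L ⇔ Overpartition (s + c) k m (map (raise s) L)
  Overpartition-raise⇔ {s} {c} {k} {m} {L} N∣s 1≤L = ⇔.trans (⇔.sym T-overpartitionᵇ)
    (⇔.trans (subst (λ b → T (overpartitionᵇ c k m L) ⇔ T b) (sym (overpartitionᵇ-raise N∣s 1≤L)) ⇔.refl)
             T-overpartitionᵇ)

  Overpartition-∷ʳ⁻ : ∀ {B c k m xs z} → (∀ {u} → T (consecOK a N u z) → B ≤ₚ u) →
    Overpartition c k m (xs ∷ʳ z) → Overpartition B (nonOverlined xs) (length xs) xs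
  Overpartition-∷ʳ⁻ {B} {xs = xs} {z} bound π = record
    { inA'N = proj₁ (All.∷ʳ⁻ inA'N) ; chain = proj₁ chain×lower ; nonOverlined≡ = refl
    ; length≡ = refl ; lowerBound = proj₂ chain×lower }
    where
    open Overpartition π
    chain×lower = chainOK-∷ʳ⁻ {B} {z} (λ {u} → bound {u}) xs chain

  Overpartition-∷ʳ⁺ : ∀ {B c k m xs p b} → (∀ {u} → B ≤ₚ u → T (consecOK a N u (p , b))) →
    T (inA'Nᵇ a N p) → c ≤ p → c ≤ B → Overpartition B k m xs →
    Overpartition c (k + χ (not b)) (suc m) (xs ∷ʳ (p , b))
  Overpartition-∷ʳ⁺ {B} {xs = xs} {p} {b} bound p∈A'N c≤p c≤B π = record
    { inA'N = All.∷ʳ⁺ inA'N p∈A'N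
    ; chain = chainOK-∷ʳ⁺ {B} {p , b} (λ {u} → bound {u}) xs chain lowerBound
    ; nonOverlined≡ = trans (nonOverlined-∷ʳ xs p b) (cong (λ j → j + χ (not b)) nonOverlined≡)
    ; length≡ = trans (length-∷ʳ xs _) (cong suc length≡)
    ; lowerBound = All.∷ʳ⁺ (All.map (≤-trans c≤B) lowerBound) c≤p }
    where open Overpartition π

  Overpartition-withBound : ∀ {c c′ k m L} → Overpartition c k m L → All (c′ ≤ₚ_) L → Overpartition c′ k m L
  Overpartition-withBound π lower = record { Overpartition π ; lowerBound = lower }

  Overpartition-positive : ∀ {c k m L} → 1 ≤ c → Overpartition c k m L → All (1 ≤ₚ_) L
  Overpartition-positive 1≤c π = All.map (≤-trans 1≤c) (Overpartition.lowerBound π)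

  Counted-overpartition⇔ : ∀ {c k m n L} → 1 ≤ c →
    Counted (overpartitionᵇ c k m) n L ⇔ (Overpartition c k m L × weight L ≡ n)
  Counted-overpartition⇔ 1≤c = mk⇔
    (λ (t , _ , weight≡) → Equivalence.to T-overpartitionᵇ t , weight≡)
    (λ (π , weight≡) → Equivalence.from T-overpartitionᵇ π , Overpartition-positive 1≤c π , weight≡)

  overpartitionᵇ-restrict : ∀ {c c′ k m L} → c ≤ c′ →
    T (overpartitionᵇ c k m L ∧ atLeastᵇ c′ L) ⇔ T (overpartitionᵇ c′ k m L)
  overpartitionᵇ-restrict {c} {c′} {k} {m} {L} c≤c′ = mk⇔
    (λ t → let t₁ , t₂ = Equivalence.to (T-∧ {overpartitionᵇ c k m L}) t
           in Equivalence.from (T-overpartitionᵇ {c′} {k} {m} {L})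
                (Overpartition-withBound (Equivalence.to (T-overpartitionᵇ {c} {k} {m} {L}) t₁)
                                         (Equivalence.to (T-atLeastᵇ {c′} {L}) t₂)))
    (λ t → let π = Equivalence.to (T-overpartitionᵇ {c′} {k} {m} {L}) t
           in Equivalence.from (T-∧ {overpartitionᵇ c k m L})
                ( Equivalence.from T-overpartitionᵇ
                    (Overpartition-withBound π (All.map (≤-trans c≤c′) (Overpartition.lowerBound π)))
                , Equivalence.from T-atLeastᵇ (Overpartition.lowerBound π)))

subsets-complete : ∀ {r} (S : Subset r) → S ∈ subsets r
subsets-complete []      = here refl
subsets-complete (b ∷ S) = ∈-concatMap⁺ (λ S → (true ∷ S) ∷ (false ∷ S) ∷ []) (lose (subsets-complete S) (b∈ b))
  where
  b∈ : ∀ b → b ∷ S ∈ (true ∷ S) ∷ (false ∷ S) ∷ []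
  b∈ true  = here refl
  b∈ false = there (here refl)

nonempty⇔ : ∀ {r} {S : Subset r} → Nonempty S ⇔ T (nonemptyᵇ S)
nonempty⇔ {r} {S} = mk⇔ (λ (x , x∈S) → ≤⇒≤ᵇ (≤-trans (s≤s z≤n) (x∈p⇒∣p-x∣<∣p∣ x∈S))) from
  where
  from : T (nonemptyᵇ S) → Nonempty S
  from t with nonempty? S
  ... | yes ne  = ne
  ... | no  ¬ne = ⊥-elim (subst (λ n → T (1 ≤ᵇ n)) (trans (cong ∣_∣ (Empty-unique ¬ne)) (∣⊥∣≡0 r)) t)

members : ∀ {r} → Subset r → List (Fin r)
members {r} S = filterᵇ (lookup S) (allFin r)

ssum≡sum-members : ∀ {r} (a : Fin r → ℕ) S → ssum a S ≡ sum (map a (members S))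
ssum≡sum-members {r} a S = sum-map-if (lookup S) a (allFin r)

members-tail : ∀ {r} b (S : Subset r) → length (filterᵇ (lookup (b ∷ S)) (tabulate suc)) ≡ length (members S)
members-tail {r} b S = trans (cong (length ∘ filterᵇ (lookup (b ∷ S))) (sym (map-tabulate (λ j → j) suc)))
                             (length-filterᵇ-map (lookup (b ∷ S)) suc (allFin r))

∣∣≡length-members : ∀ {r} (S : Subset r) → ∣ S ∣ ≡ length (members S)
∣∣≡length-members []          = refl
∣∣≡length-members (true ∷ S)  = cong suc (trans (∣∣≡length-members S) (sym (members-tail true S)))
∣∣≡length-members (false ∷ S) = trans (∣∣≡length-members S) (sym (members-tail false S))

ssum-≥-member : ∀ {r} (a : Fin r → ℕ) S {k} → lookup S k ≡ true → a k ≤ ssum a S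
ssum-≥-member {r} a S {k} k∈S = subst (_≤ ssum a S) (cong (λ b → if b then a k else 0) k∈S)
  (go (allFin r) (∈-allFin k))
  where
  go : ∀ xs → k ∈ xs → (if lookup S k then a k else 0) ≤ sum (map (λ j → if lookup S j then a j else 0) xs)
  go (_ ∷ xs) (here refl) = m≤m+n _ _
  go (_ ∷ xs) (there k∈) = ≤-trans (go xs k∈) (m≤n+m _ _)

minElem-bounds : ∀ {r N} (a : Fin r → ℕ) {S} → (∀ k → 1 ≤ a k) → (∀ k → a k ≤ N) → T (nonemptyᵇ S) →
                 1 ≤ minElem a S × ssum a S ≤ minElem a S + (∣ S ∣ ∸ 1) * N
minElem-bounds {N = N} a {S} a≥1 a≤N ne =
  let 1≤μ , bound = minimum-bounds ys (subst (1 ≤_) ∣S∣≡length (≤ᵇ⇒≤ 1 _ ne))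
                      (All.map⁺ (All.tabulate λ {k} _ → a≥1 k)) (All.map⁺ (All.tabulate λ {k} _ → a≤N k))
  in 1≤μ , subst₂ (λ σ n → σ ≤ minElem a S + (n ∸ 1) * N) (sym (ssum≡sum-members a S)) (sym ∣S∣≡length) bound
  where
  ys = map a (members S)
  ∣S∣≡length : ∣ S ∣ ≡ length ys
  ∣S∣≡length = trans (∣∣≡length-members S) (sym (length-map a (members S)))

w-v-witness : ∀ {r} (a : Fin r → ℕ) {β} → InA' a β →
  Σ (Subset r) λ S → T (nonemptyᵇ S) × ssum a S ≡ β × w a β ≡ ∣ S ∣ × v a β ≡ minElem a S
w-v-witness {r} a {β} (S₀ , ne , sum≡β) with subsetsSumming a β in eq
... | []    = case subst (S₀ ∈_) eq S₀∈ of λ ()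
  where
  S₀∈ : S₀ ∈ subsetsSumming a β
  S₀∈ = ∈-filter⁺ (T? ∘ λ S → nonemptyᵇ S ∧ (ssum a S ≡ᵇ β)) (subsets-complete S₀)
          (Equivalence.from T-∧ (Equivalence.to nonempty⇔ ne , ≡⇒≡ᵇ _ _ sum≡β))
... | S ∷ _ = S , ne′ , ≡ᵇ⇒≡ _ _ sum≡ᵇβ , refl , refl
  where
  summing = proj₂ (∈-filter⁻ (T? ∘ λ S → nonemptyᵇ S ∧ (ssum a S ≡ᵇ β)) {xs = subsets r}
                              (subst (S ∈_) (sym eq) (here refl)))
  ne′ = proj₁ (Equivalence.to (T-∧ {nonemptyᵇ S}) summing)
  sum≡ᵇβ = proj₂ (Equivalence.to (T-∧ {nonemptyᵇ S}) summing)

-- The setting of the theorem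

module Superincreasing {r₀ : ℕ} (a : Fin (suc r₀) → ℕ) (superincreasing : ∀ k → ssum a (below k) < a k) where

  a₀-positive : 1 ≤ a zero
  a₀-positive = ≤-trans (s≤s z≤n) (superincreasing zero)

  a₀-least : ∀ k → a zero ≤ a k
  a₀-least zero    = ≤-refl
  a₀-least (suc k) = ≤-trans (ssum-≥-member a (below (suc k)) {zero} refl) (<⇒≤ (superincreasing (suc k)))

  a-positive : ∀ k → 1 ≤ a k
  a-positive k = ≤-trans a₀-positive (a₀-least k)

  a₀-≤-A' : ∀ {β} → InA' a β → a zero ≤ β
  a₀-≤-A' (S , (j , j∈S) , refl) = ≤-trans (a₀-least j) (ssum-≥-member a S ([]=⇒lookup j∈S))

module Setting (r₀ : ℕ) (a : Fin (suc r₀) → ℕ)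
  (superincreasing : ∀ k → ssum a (below k) < a k)
  (α : ℕ → ℕ)
  (α-increasing : ∀ i j → 1 ≤ i → i < j → j ≤ 2 ^ suc r₀ ∸ 1 → α i < α j)
  (α-A' : ∀ i → 1 ≤ i → i ≤ 2 ^ suc r₀ ∸ 1 → InA' a (α i))
  (α-onto : ∀ β → InA' a β → Σ ℕ λ i → 1 ≤ i × i ≤ 2 ^ suc r₀ ∸ 1 × α i ≡ β)
  (N-1 : ℕ) (α[M]≤N : α (2 ^ suc r₀ ∸ 1) ≤ suc N-1)
  (α-top : α (2 ^ suc r₀) ≡ suc N-1 + a zero)
  where

  open Superincreasing a superincreasing
  open Overpartitions a N-1

  M : ℕ
  M = 2 ^ suc r₀ ∸ 1

  α-monotone : ∀ {i j} → 1 ≤ i → i ≤ j → j ≤ M → α i ≤ α j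
  α-monotone 1≤i i≤j j≤M with m≤n⇒m<n∨m≡n i≤j
  ... | inj₁ i<j  = <⇒≤ (α-increasing _ _ 1≤i i<j j≤M)
  ... | inj₂ refl = ≤-refl

  A'-≤-N : ∀ {β} → InA' a β → β ≤ N
  A'-≤-N β∈A' with α-onto _ β∈A'
  ... | j , 1≤j , j≤M , refl = ≤-trans (α-monotone 1≤j j≤M ≤-refl) α[M]≤N

  a-≤-N : ∀ k → a k ≤ N
  a-≤-N k = ≤-trans (ssum-≥-member a ⊤ (lookup-replicate k true)) (A'-≤-N (⊤ , (k , ∈⊤) , refl))

  α-step : ∀ {i} → 1 ≤ i → i ≤ M → α i < α (suc i) × α (suc i) ≤ N + a zero
  α-step {i} 1≤i i≤M with m≤n⇒m<n∨m≡n i≤M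
  ... | inj₁ i<M  = α-increasing i (suc i) 1≤i ≤-refl i<M
                  , ≤-trans (A'-≤-N (α-A' (suc i) (s≤s z≤n) i<M)) (m≤m+n N (a zero))
  ... | inj₂ refl = subst (α M <_) (sym α[1+M]) (≤-<-trans (A'-≤-N (α-A' M 1≤i ≤-refl)) (m<m+n N a₀-positive))
                  , ≤-reflexive α[1+M]
    where
    α[1+M] : α (suc M) ≡ N + a zero
    α[1+M] = trans (cong α (suc-pred (2 ^ suc r₀) {{m^n≢0 2 (suc r₀)}})) α-top

  α-isolated : ∀ {i j} → 1 ≤ i → i ≤ M → 1 ≤ j → j ≤ M → α i ≤ α j → α j < α (suc i) → α j ≡ α i
  α-isolated {i} {j} 1≤i i≤M 1≤j j≤M αi≤αj αj<α[1+i] with <-cmp j i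
  ... | tri< j<i _ _ = ⊥-elim (<⇒≱ (α-increasing j i 1≤j j<i i≤M) αi≤αj)
  ... | tri≈ _ refl _ = refl
  ... | tri> _ _ i<j = ⊥-elim (<⇒≱ αj<α[1+i] (α-monotone (s≤s z≤n) i<j j≤M))

  A'-window : ∀ {β} → InA' a β → a zero ≤ β × β < a zero + N
  A'-window β∈A' = a₀-≤-A' β∈A' , ≤-<-trans (A'-≤-N β∈A') (m<n+m N a₀-positive)

  A'N-gap : ∀ {i x} → 1 ≤ i → i ≤ M → T (inA'Nᵇ a N x) → α i ≤ x → x < α (suc i) → x ≡ α i
  A'N-gap {i} {x} 1≤i i≤M x∈A'N αi≤x x<α[1+i] =
    let S , _ , t       = find (any⁻ _ (subsets (suc r₀)) (proj₂ (Equivalence.to (T-∧ {1 ≤ᵇ x}) x∈A'N)))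
        ne , x≡S        = Equivalence.to (T-∧ {nonemptyᵇ S}) t
        S∈A'            = S , Equivalence.from nonempty⇔ ne , refl
        j , 1≤j , j≤M , αj≡ = α-onto (ssum a S) S∈A'
        a₀≤S , S<a₀+N   = A'-window S∈A'
        a₀≤x            = ≤-trans (a₀-≤-A' (α-A' i 1≤i i≤M)) αi≤x
        x<a₀+N          = <-≤-trans x<α[1+i] (≤-trans (proj₂ (α-step 1≤i i≤M)) (≤-reflexive (+-comm N (a zero))))
        x≡αj            = trans (%-injective-window a₀≤x x<a₀+N a₀≤S S<a₀+N (≡ᵇ⇒≡ _ _ x≡S)) (sym αj≡)
    in trans x≡αj (α-isolated 1≤i i≤M 1≤j j≤M (subst (α i ≤_) x≡αj αi≤x) (subst (_< α (suc i)) x≡αj x<α[1+i]))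

  α-A'N : ∀ {i} → 1 ≤ i → i ≤ M → T (inA'Nᵇ a N (α i))
  α-A'N {i} 1≤i i≤M with α-A' i 1≤i i≤M
  ... | S , ne , ssum≡αi = Equivalence.from (T-∧ {1 ≤ᵇ α i})
    ( ≤⇒≤ᵇ (≤-trans a₀-positive (a₀-≤-A' (S , ne , ssum≡αi)))
    , any⁺ _ (lose (subsets-complete S)
        (Equivalence.from (T-∧ {nonemptyᵇ S}) (Equivalence.to nonempty⇔ ne , ≡⇒≡ᵇ _ _ (cong (_% N) (sym ssum≡αi))))))

  βN-id : ∀ {m} → 1 ≤ m → m ≤ N → βN N m ≡ m
  βN-id {suc m} _ m≤N with m≤n⇒m<n∨m≡n m≤N
  ... | inj₁ m<N  = cong (λ ρ → if ρ ≡ᵇ 0 then N else ρ) (m<n⇒m%n≡m m<N)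
  ... | inj₂ refl = cong (λ ρ → if ρ ≡ᵇ 0 then N else ρ) (n%n≡0 N)

  α-positive : ∀ {i} → 1 ≤ i → i ≤ M → 1 ≤ α i
  α-positive 1≤i i≤M = ≤-trans a₀-positive (a₀-≤-A' (α-A' _ 1≤i i≤M))

  module Window {i : ℕ} (1≤i : 1 ≤ i) (i≤M : i ≤ M) where

    W V : ℕ
    W = w a (α i)
    V = v a (α i)

    W-V-bounds : 1 ≤ W × 1 ≤ V × α i ≤ V + (W ∸ 1) * N
    W-V-bounds with w-v-witness a (α-A' i 1≤i i≤M)
    ... | S , ne , ssum≡αi , W≡ , V≡ =
      let 1≤μ , bound = minElem-bounds a {S} a-positive a-≤-N ne
      in subst (1 ≤_) (sym W≡) (≤ᵇ⇒≤ 1 _ ne) , subst (1 ≤_) (sym V≡) 1≤μ ,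
         subst₂ (λ μ s → α i ≤ μ + (s ∸ 1) * N) (sym V≡) (sym W≡) (subst (_≤ _) ssum≡αi bound)

    W-positive : 1 ≤ W
    W-positive = proj₁ W-V-bounds

    V-positive : 1 ≤ V
    V-positive = proj₁ (proj₂ W-V-bounds)

    α-≤-N : α i ≤ N
    α-≤-N = A'-≤-N (α-A' i 1≤i i≤M)

    -- N (w(α i) - 1 + χ b), in the two forms that occur in the theorem.
    gap : Bool → ℕ
    gap true  = N * W
    gap false = N * (W ∸ 1)

    N∣gap : ∀ b → N ∣ gap b
    N∣gap true  = m∣m*n W
    N∣gap false = m∣m*n (W ∸ 1)

    N*[W+χ]≡gap+N : ∀ b → N * (W + χ b) ≡ gap b + N
    N*[W+χ]≡gap+N true  = trans (*-distribˡ-+ N W 1) (cong (λ x → N * W + x) (*-identityʳ N))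
    N*[W+χ]≡gap+N false = begin
      N * (W + 0)         ≡⟨ cong (N *_) (trans (+-identityʳ W) (sym (m∸n+n≡m W-positive))) ⟩
      N * (W ∸ 1 + 1)     ≡⟨ *-distribˡ-+ N (W ∸ 1) 1 ⟩
      N * (W ∸ 1) + N * 1 ≡⟨ cong (λ x → N * (W ∸ 1) + x) (*-identityʳ N) ⟩
      N * (W ∸ 1) + N     ∎
      where open ≡-Reasoning

    α-≤-gap+V : ∀ b → α i ≤ gap b + V
    α-≤-gap+V true  = ≤-trans (≤-trans α-≤-N (m≤m*n N W {{>-nonZero W-positive}})) (m≤m+n (N * W) V)
    α-≤-gap+V false = ≤-trans (proj₂ (proj₂ W-V-bounds))
                              (≤-reflexive (trans (+-comm V _) (cong (_+ V) (*-comm (W ∸ 1) N))))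

    α-<-gap+V : α i < gap true + V
    α-<-gap+V = ≤-<-trans (≤-trans α-≤-N (m≤m*n N W {{>-nonZero W-positive}})) (m<m+n (N * W) V-positive)

    consecOK-onto-unfolded : ∀ p c b → consecOK a N (p , c) (α i , b) ≡
      (α i ≤ᵇ p) ∧ (not (p ≡ᵇ α i) ∨ not b)
      ∧ ((+ (N * (W + χ b))) ℤ.- (+ N) ℤ.+ (+ V) ℤ.- (+ α i) ℤ.≤ᵇ (+ p) ℤ.- (+ α i))
    consecOK-onto-unfolded p c b rewrite βN-id (α-positive 1≤i i≤M) α-≤-N = refl

    distinct-or-unmarked : ∀ b {p} → gap b + V ≤ p → T (not (p ≡ᵇ α i) ∨ not b)
    distinct-or-unmarked false {p} _ = Equivalence.from (T-∨ {not (p ≡ᵇ α i)}) (inj₂ _)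
    distinct-or-unmarked true {p} gap+V≤p = Equivalence.from (T-∨ {not (p ≡ᵇ α i)})
      (inj₁ (Equivalence.from T-not⇔¬T λ p≡ᵇαi →
        <⇒≱ α-<-gap+V (subst (gap true + V ≤_) (≡ᵇ⇒≡ p (α i) p≡ᵇαi) gap+V≤p)))

    consecOK-onto⇔ : ∀ b {u} → T (consecOK a N u (α i , b)) ⇔ gap b + V ≤ₚ u
    consecOK-onto⇔ b {p , c} rewrite consecOK-onto-unfolded p c b = mk⇔ to from
      where
      rearrange : N * (W + χ b) + V ≡ gap b + V + N
      rearrange = trans (cong (_+ V) (N*[W+χ]≡gap+N b)) (xy∙z≈xz∙y (gap b) N V)
      to : T _ → gap b + V ≤ p
      to t = let _ , t′ = Equivalence.to (T-∧ {α i ≤ᵇ p}) t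
                 _ , diff = Equivalence.to (T-∧ {not (p ≡ᵇ α i) ∨ not b}) t′
             in +-cancelʳ-≤ N _ _ (subst (_≤ p + N) rearrange
                  (Equivalence.to (difference-≤ᵇ⇔ (N * (W + χ b)) N V (α i) p) diff))
      from : gap b + V ≤ p → T _
      from gap+V≤p = Equivalence.from (T-∧ {α i ≤ᵇ p})
        ( ≤⇒≤ᵇ (≤-trans (α-≤-gap+V b) gap+V≤p)
        , Equivalence.from (T-∧ {not (p ≡ᵇ α i) ∨ not b})
            ( distinct-or-unmarked b gap+V≤p
            , Equivalence.from (difference-≤ᵇ⇔ (N * (W + χ b)) N V (α i) p)
                (subst (_≤ p + N) (sym rearrange) (+-monoˡ-≤ N gap+V≤p))))

    dropSmallest : ∀ {b k m} xs → Overpartition (α i) k m (xs ∷ʳ (α i , b)) →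
                  Overpartition (gap b + V) (nonOverlined xs) (length xs) xs
    dropSmallest {b} xs = Overpartition-∷ʳ⁻ {xs = xs} {α i , b} (λ {u} → Equivalence.to (consecOK-onto⇔ b {u}))

    embed : Bool → List Part → List Part
    embed b L′ = map (raise (gap b)) L′ ∷ʳ (α i , b)

    embed-injective : ∀ b → Injective _≡_ _≡_ (embed b)
    embed-injective b eq = map-raise-injective (gap b) (proj₁ (∷ʳ-injective _ _ eq))

    weight-embed : ∀ b L′ → weight (embed b L′) ≡ gap b * length L′ + weight L′ + α i
    weight-embed b L′ = trans (weight-∷ʳ (map (raise (gap b)) L′) (α i , b)) (cong (_+ α i) (weight-raise (gap b) L′))

    attach : ∀ {b k m L′} → Overpartition V k m L′ → Overpartition (α i) (k + χ (not b)) (suc m) (embed b L′)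
    attach {b} {L′ = L′} π =
      Overpartition-∷ʳ⁺ {xs = map (raise (gap b)) L′} (λ {u} → Equivalence.from (consecOK-onto⇔ b {u}))
        (α-A'N 1≤i i≤M) ≤-refl (α-≤-gap+V b)
        (Equivalence.to (Overpartition-raise⇔ (N∣gap b) (Overpartition-positive V-positive π)) π)

    detach : ∀ {b k m} xs → Overpartition (α i) k m (xs ∷ʳ (α i , b)) →
           ∃ λ L′ → Overpartition V (k ∸ χ (not b)) (m ∸ 1) L′ × embed b L′ ≡ xs ∷ʳ (α i , b)
    detach {b} {k} {m} xs π with raised-decomposition (gap b) xs (Overpartition.lowerBound (dropSmallest xs π))
    ... | L′ , L′≥V , refl = L′ , subst₂ (λ k′ m′ → Overpartition V k′ m′ L′) nonOverlined≡ length≡ π′ , refl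
      where
      π′ = Equivalence.from (Overpartition-raise⇔ (N∣gap b) (All.map (≤-trans V-positive) L′≥V)) (dropSmallest xs π)
      nonOverlined≡ : nonOverlined xs ≡ k ∸ χ (not b)
      nonOverlined≡ = trans (sym (m+n∸n≡m _ (χ (not b))))
        (cong (_∸ χ (not b)) (trans (sym (nonOverlined-∷ʳ xs (α i) b)) (Overpartition.nonOverlined≡ π)))
      length≡ : length xs ≡ m ∸ 1
      length≡ = cong ℕ.pred (trans (sym (length-∷ʳ xs _)) (Overpartition.length≡ π))

    -- Counted by f_{α i} but not by f_{α (i+1)}, with smallest part overlined iff b.
    windowᵇ : Bool → ℕ → ℕ → List Part → Bool
    windowᵇ b k m L = (overpartitionᵇ (α i) k m L ∧ not (atLeastᵇ (α (suc i)) L)) ∧ lastMarkedᵇ b L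

    T-windowᵇ : ∀ {b k m L} → T (windowᵇ b k m L) ⇔
                (Overpartition (α i) k m L × ¬ All (α (suc i) ≤ₚ_) L × lastMark L ≡ b)
    T-windowᵇ {b} {k} {m} {L} = mk⇔
      (λ t → let t₁ , marked = Equivalence.to (T-∧ {overpartitionᵇ (α i) k m L ∧ not (atLeastᵇ (α (suc i)) L)}) t
                 π , below = Equivalence.to (T-∧ {overpartitionᵇ (α i) k m L}) t₁
             in Equivalence.to T-overpartitionᵇ π
              , Equivalence.to T-not⇔¬T below ∘ Equivalence.from T-atLeastᵇ
              , Equivalence.to (T-lastMarkedᵇ b) marked)
      (λ (π , ¬above , marked) →
         Equivalence.from (T-∧ {overpartitionᵇ (α i) k m L ∧ not (atLeastᵇ (α (suc i)) L)})
           ( Equivalence.from (T-∧ {overpartitionᵇ (α i) k m L})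
               (Equivalence.from T-overpartitionᵇ π , Equivalence.from T-not⇔¬T (¬above ∘ Equivalence.to T-atLeastᵇ))
           , Equivalence.from (T-lastMarkedᵇ b) marked))

    smallest-part : ∀ {b k m L} → T (windowᵇ b k m L) → ∃ λ xs → L ≡ xs ∷ʳ (α i , b)
    smallest-part {b} {k} {m} {L} t with Equivalence.to (T-windowᵇ {b} {k} {m} {L}) t | initLast L
    ... | _ , ¬above , _     | []            = ⊥-elim (¬above [])
    ... | π , ¬above , marked | xs ∷ʳ′ (p , c) = xs , cong (xs ∷ʳ_) (cong₂ _,_ p≡αi c≡b)
      where
      open Overpartition π
      xs≥p : All (p ≤ₚ_) xs
      xs≥p = proj₂ (chainOK-∷ʳ⁻ {p} {p , c} (λ {u} → consecOK-decreasing {u}) xs chain)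
      p<α[1+i] : p < α (suc i)
      p<α[1+i] = ≰⇒> λ α[1+i]≤p → ¬above (All.∷ʳ⁺ (All.map (≤-trans α[1+i]≤p) xs≥p) α[1+i]≤p)
      p≡αi : p ≡ α i
      p≡αi = A'N-gap 1≤i i≤M (proj₂ (All.∷ʳ⁻ inA'N)) (proj₂ (All.∷ʳ⁻ lowerBound)) p<α[1+i]
      c≡b : c ≡ b
      c≡b = trans (sym (lastMark-∷ʳ xs (p , c))) marked

    window-decompose : ∀ {b k m n L} → Counted (windowᵇ b k m) n L →
      ((χ (not b) ≤ k × 1 ≤ m × α i ≤ n) × gap b * (m ∸ 1) ≤ n ∸ α i) ×
      ∃ λ L′ → Counted (overpartitionᵇ V (k ∸ χ (not b)) (m ∸ 1)) (n ∸ α i ∸ gap b * (m ∸ 1)) L′ × embed b L′ ≡ L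
    window-decompose {b} {k} {m} {n} {L} (t , _ , weight≡n) with smallest-part {b} {k} {m} {L} t
    ... | xs , refl with detach xs (proj₁ (Equivalence.to (T-windowᵇ {b} {k} {m} {xs ∷ʳ (α i , b)}) t))
    ...   | L′ , π′ , embed≡ =
      ((χ≤k , 1≤m , proj₁ split) , proj₁ (proj₂ split)) ,
      L′ , Equivalence.from (Counted-overpartition⇔ V-positive) (π′ , proj₂ (proj₂ split)) , embed≡
      where
      π = proj₁ (Equivalence.to (T-windowᵇ {b} {k} {m} {xs ∷ʳ (α i , b)}) t)
      χ≤k : χ (not b) ≤ k
      χ≤k = subst (χ (not b) ≤_) (trans (sym (nonOverlined-∷ʳ xs (α i) b)) (Overpartition.nonOverlined≡ π)) (m≤n+m _ _)
      1≤m : 1 ≤ m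
      1≤m = subst (1 ≤_) (trans (sym (length-∷ʳ xs _)) (Overpartition.length≡ π)) (s≤s z≤n)
      split : α i ≤ n × gap b * (m ∸ 1) ≤ n ∸ α i × weight L′ ≡ n ∸ α i ∸ gap b * (m ∸ 1)
      split = Equivalence.to m+n+p≡o⇔ (begin
        gap b * (m ∸ 1) + weight L′ + α i       ≡⟨ cong (λ l → gap b * l + weight L′ + α i) (Overpartition.length≡ π′) ⟨
        gap b * length L′ + weight L′ + α i     ≡⟨ weight-embed b L′ ⟨
        weight (embed b L′)                     ≡⟨ cong weight embed≡ ⟩
        weight (xs ∷ʳ (α i , b))                ≡⟨ weight≡n ⟩
        n                                       ∎)
        where open ≡-Reasoning

    window-compose : ∀ {b k m n L′} → χ (not b) ≤ k × 1 ≤ m × α i ≤ n → gap b * (m ∸ 1) ≤ n ∸ α i →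
      Counted (overpartitionᵇ V (k ∸ χ (not b)) (m ∸ 1)) (n ∸ α i ∸ gap b * (m ∸ 1)) L′ →
      Counted (windowᵇ b k m) n (embed b L′)
    window-compose {b} {k} {m} {n} {L′} (χ≤k , 1≤m , αi≤n) G≤ counted =
      Equivalence.from (T-windowᵇ {b} {k} {m} {embed b L′})
        (π′ , ¬above , lastMark-∷ʳ (map (raise (gap b)) L′) (α i , b)) ,
      Overpartition-positive (α-positive 1≤i i≤M) π′ ,
      weight≡n
      where
      π,weight = Equivalence.to (Counted-overpartition⇔ {V} {k ∸ χ (not b)} {m ∸ 1} {L = L′} V-positive) counted
      π = proj₁ π,weight
      π′ : Overpartition (α i) k m (embed b L′)
      π′ = subst₂ (λ k′ m′ → Overpartition (α i) k′ m′ (embed b L′))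
             (m∸n+n≡m χ≤k) (trans (+-comm 1 (m ∸ 1)) (m∸n+n≡m 1≤m)) (attach π)
      ¬above : ¬ All (α (suc i) ≤ₚ_) (embed b L′)
      ¬above above = <⇒≱ (proj₁ (α-step 1≤i i≤M)) (proj₂ (All.∷ʳ⁻ above))
      weight≡n : weight (embed b L′) ≡ n
      weight≡n = trans (weight-embed b L′)
        (trans (cong (λ l → gap b * l + weight L′ + α i) (Overpartition.length≡ π))
               (Equivalence.from m+n+p≡o⇔ (αi≤n , G≤ , proj₂ π,weight)))

    window-count : ∀ b k m n →
      + count (windowᵇ b k m) n ≡ monomial (χ (not b)) 1 (α i) (substXq (gap b) (f a N V)) k m n
    window-count b k m n with ((χ (not b) ≤? k) ×-dec (1 ≤? m) ×-dec (α i ≤? n)) ×-dec (gap b * (m ∸ 1) ≤? n ∸ α i)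
    ... | yes (support , fits) =
      trans (cong +_ (count-≡-by-embedding (embed b) (embed-injective b) (window-compose support fits)
                        (proj₂ ∘ window-decompose)))
            (sym (monomial-substXq-fits (χ (not b)) 1 (α i) (gap b) (f a N V) k m n support fits))
    ... | no ¬fits =
      trans (cong +_ (count-zero (¬fits ∘ proj₁ ∘ window-decompose)))
            (sym (monomial-substXq-unfit (χ (not b)) 1 (α i) (gap b) (f a N V) k m n ¬fits))

    window-split : ∀ k m n → count (overpartitionᵇ (α i) k m) n ≡
      count (overpartitionᵇ (α (suc i)) k m) n + (count (windowᵇ true k m) n + count (windowᵇ false k m) n)
    window-split k m n = trans (count-split (overpartitionᵇ (α i) k m) (atLeastᵇ (α (suc i))) n)
      (cong₂ _+_ (count-cong {λ L → overpartitionᵇ (α i) k m L ∧ atLeastᵇ (α (suc i)) L}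
                             {overpartitionᵇ (α (suc i)) k m} {n}
                             (λ {L} _ → overpartitionᵇ-restrict {L = L} (<⇒≤ (proj₁ (α-step 1≤i i≤M)))))
                 (count-split (λ L → overpartitionᵇ (α i) k m L ∧ not (atLeastᵇ (α (suc i)) L)) lastMark n))

    difference : (f a N (α i) ⊖ f a N (α (suc i)))
                   ≋ (monomial 0 1 (α i) (substXq (N * W) (f a N V))
                      ⊕ monomial 1 1 (α i) (substXq (N * (W ∸ 1)) (f a N V)))
    difference k m n = begin
      + count (overpartitionᵇ (α i) k m) n ℤ.- + above
        ≡⟨ cong (λ c → + c ℤ.- + above) (window-split k m n) ⟩
      + (above + (count (windowᵇ true k m) n + count (windowᵇ false k m) n)) ℤ.- + above
        ≡⟨ [+[m+n]]-[+m]≡+n above (count (windowᵇ true k m) n + count (windowᵇ false k m) n) ⟩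
      + (count (windowᵇ true k m) n + count (windowᵇ false k m) n)
        ≡⟨ ℤ.pos-+ (count (windowᵇ true k m) n) (count (windowᵇ false k m) n) ⟩
      + count (windowᵇ true k m) n ℤ.+ + count (windowᵇ false k m) n
        ≡⟨ cong₂ ℤ._+_ (window-count true k m n) (window-count false k m n) ⟩
      monomial 0 1 (α i) (substXq (N * W) (f a N V)) k m n
        ℤ.+ monomial 1 1 (α i) (substXq (N * (W ∸ 1)) (f a N V)) k m n ∎
      where
      open ≡-Reasoning
      above = count (overpartitionᵇ (α (suc i)) k m) n

  shift-lift : ∀ {k m n L′} → N * m ≤ n → Counted (overpartitionᵇ (a zero) k m) (n ∸ N * m) L′ →
               Counted (overpartitionᵇ (N + a zero) k m) n (map (raise N) L′)
  shift-lift {L′ = L′} fits counted =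
    let π , weight≡ = Equivalence.to (Counted-overpartition⇔ a₀-positive) counted
        π′ = Equivalence.to (Overpartition-raise⇔ ∣-refl (Overpartition-positive a₀-positive π)) π
    in Equivalence.from (Counted-overpartition⇔ (≤-trans a₀-positive (m≤n+m _ N)))
         (π′ , trans (weight-raise N L′) (trans (cong (λ l → N * l + weight L′) (Overpartition.length≡ π))
                                                (Equivalence.from m+n≡o⇔ (fits , weight≡))))

  shift-lower : ∀ {k m n L} → Counted (overpartitionᵇ (N + a zero) k m) n L →
    N * m ≤ n × ∃ λ L′ → Counted (overpartitionᵇ (a zero) k m) (n ∸ N * m) L′ × map (raise N) L′ ≡ L
  shift-lower {k} {m} {n} {L} counted
    with Equivalence.to (Counted-overpartition⇔ (≤-trans a₀-positive (m≤n+m _ N))) counted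
  ... | π , weight≡ with raised-decomposition N L (Overpartition.lowerBound π)
  ...   | L′ , L′≥a₀ , refl =
    proj₁ split , L′ , Equivalence.from (Counted-overpartition⇔ a₀-positive) (π′ , proj₂ split) , refl
    where
    π′ = Equivalence.from (Overpartition-raise⇔ ∣-refl (All.map (≤-trans a₀-positive) L′≥a₀)) π
    split : N * m ≤ n × weight L′ ≡ n ∸ N * m
    split = Equivalence.to m+n≡o⇔ (trans (cong (λ l → N * l + weight L′) (sym (Overpartition.length≡ π′)))
                                       (trans (sym (weight-raise N L′)) weight≡))

  shift-by-N : f a N (N + a zero) ≋ substXq N (f a N (a zero))
  shift-by-N k m n with N * m ≤? n
  ... | yes fits = trans (cong +_ (count-≡-by-embedding (map (raise N)) (map-raise-injective N) (shift-lift fits)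
                                     (proj₂ ∘ shift-lower)))
                         (sym (substXq-fits N (f a N (a zero)) k m n fits))
  ... | no ¬fits = trans (cong +_ (count-zero (¬fits ∘ proj₁ ∘ shift-lower)))
                         (sym (substXq-unfit N (f a N (a zero)) k m n ¬fits))

2^[1+r]∸1-positive : ∀ r → 1 ≤ 2 ^ suc r ∸ 1
2^[1+r]∸1-positive r = ∸-monoˡ-≤ 1 (*-monoʳ-≤ 2 (m^n>0 2 r))

lemma2 : (r₀ : ℕ) (a : Fin (suc r₀) → ℕ)
    → (∀ i j → a i ≡ a j → i ≡ j)
    → (∀ k → ssum a (below k) < a k)
    → (∀ (S T : Subset (suc r₀)) → Nonempty S → Nonempty T → ssum a S ≡ ssum a T → S ≡ T)
    → (α : ℕ → ℕ)
    → (∀ i j → 1 ≤ i → i < j → j ≤ 2 ^ suc r₀ ∸ 1 → α i < α j)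
    → (∀ i → 1 ≤ i → i ≤ 2 ^ suc r₀ ∸ 1 → InA' a (α i))
    → (∀ β → InA' a β → Σ ℕ λ i → 1 ≤ i × i ≤ 2 ^ suc r₀ ∸ 1 × α i ≡ β)
    → (N : ℕ) → α (2 ^ suc r₀ ∸ 1) ≤ N
    → α (2 ^ suc r₀) ≡ N + a zero
    → (∀ i → 1 ≤ i → i ≤ 2 ^ suc r₀ ∸ 1 →
          (f a N (α i) ⊖ f a N (α (suc i)))
            ≋ (monomial 0 1 (α i) (substXq (N * w a (α i)) (f a N (v a (α i))))
               ⊕ monomial 1 1 (α i) (substXq (N * (w a (α i) ∸ 1)) (f a N (v a (α i))))))
      × (f a N (α (2 ^ suc r₀)) ≋ substXq N (f a N (a zero)))
lemma2 r₀ a _ superincreasing _ α _ α-A' _ zero α[M]≤0 _ = case 1≤0 of λ ()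
  where
  open Superincreasing a superincreasing
  1≤0 : 1 ≤ 0
  1≤0 = ≤-trans (≤-trans a₀-positive (a₀-≤-A' (α-A' _ (2^[1+r]∸1-positive r₀) ≤-refl))) α[M]≤0
lemma2 r₀ a _ superincreasing _ α α-increasing α-A' α-onto (suc N-1) α[M]≤N α-top =
  (λ i 1≤i i≤M → Window.difference 1≤i i≤M) ,
  subst (λ c → f a (suc N-1) c ≋ substXq (suc N-1) (f a (suc N-1) (a zero))) (sym α-top) shift-by-N
  where open Setting r₀ a superincreasing α α-increasing α-A' α-onto N-1 α[M]≤N α-top
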